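{- Let $r,s,t$ be terms with $r\times s\rightleftarrows^* t$. Then either (1) $t=u\times v$ for some $u,v$, where one of the following holds: (a) there are $t_{11},t_{12},t_{21},t_{22}$ with $u\rightleftarrows^* t_{11}\times t_{21}$, $v\rightleftarrows^* t_{12}\times t_{22}$, $r\rightleftarrows^* t_{11}\times t_{12}$ and $s\rightleftarrows^* t_{21}\times t_{22}$; or (b) there is $w$ with $v\rightleftarrows^* w\times s$ and $r\rightleftarrows^* u\times w$, or one of the three cases obtained from this by exchanging the roles of $r$ and $s$ and/or of $u$ and $v$; or (c) $r\rightleftarrows^* u$ and $s\rightleftarrows^* v$, or $r\rightleftarrows^* v$ and $s\rightleftarrows^* u$; or (2) $t=\lambda x^A.a$ with $a\rightleftarrows^* a_1\times a_2$, $r\rightleftarrows^*\lambda x^A.a_1$ and $s\rightleftarrows^*\lambda x^A.a_2$ for some $a_1,a_2$.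
   Context: Types are generated by $A ::= \tau \mid A\Rightarrow A \mid A\wedge A$. Preterms are $r ::= x \mid \lambda x.r \mid rr \mid r\times r \mid \pi_A(r)$ (application left associative), where variables are drawn from sets $\mathcal V_A$ indexed by types (up to type isomorphism); one writes $\lambda x^A.r$ for $\lambda x.r$ when $x\in\mathcal V_A$. Terms are the well-typed preterms of the calculus. The relation $\rightleftarrows$ is the smallest symmetric relation on terms, closed under all term contexts (abstraction, both sides of application, both sides of product, projection), containing: $r\times s\rightleftarrows s\times r$; $(r\times s)\times t\rightleftarrows r\times(s\times t)$; $\lambda x^A.(r\times s)\rightleftarrows \lambda x^A.r\times\lambda x^A.s$; $rst\rightleftarrows r(s\times t)$. $\rightleftarrows^*$ is its reflexive transitive closure. -}

module Defs where

open import Data.Nat using (ℕ)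
open import Data.Product using (Σ; ∃; _×_; _,_)
open import Data.Sum using (_⊎_)
open import Relation.Binary.Construct.Closure.ReflexiveTransitive using (Star)

infixr 7 _⇒_
infixr 8 _∧_

data Ty : Set where
  τ   : Ty
  _⇒_ : Ty → Ty → Ty
  _∧_ : Ty → Ty → Ty

infix 4 _≅_
data _≅_ : Ty → Ty → Set where
  comm   : ∀ {A B} → A ∧ B ≅ B ∧ A
  asso   : ∀ {A B C} → (A ∧ B) ∧ C ≅ A ∧ (B ∧ C)
  dist   : ∀ {A B C} → A ⇒ (B ∧ C) ≅ (A ⇒ B) ∧ (A ⇒ C)
  curry  : ∀ {A B C} → (A ∧ B) ⇒ C ≅ A ⇒ B ⇒ C
  ≅-refl  : ∀ {A} → A ≅ A
  ≅-sym   : ∀ {A B} → A ≅ B → B ≅ A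
  ≅-trans : ∀ {A B C} → A ≅ B → B ≅ C → A ≅ C
  cong⇒ : ∀ {A A' B B'} → A ≅ A' → B ≅ B' → A ⇒ B ≅ A' ⇒ B'
  cong∧ : ∀ {A A' B B'} → A ≅ A' → B ≅ B' → A ∧ B ≅ A' ∧ B'

-- Preterms.  A variable is a name together with its type (x ∈ 𝒱_A);
-- λ x^A . r is  lam x A r ;  π_A(r) is  proj A r .
infixl 9 _·_
infixr 6 _⊗_
data PTerm : Set where
  var  : ℕ → Ty → PTerm
  lam  : ℕ → Ty → PTerm → PTerm
  _·_  : PTerm → PTerm → PTerm
  _⊗_  : PTerm → PTerm → PTerm
  proj : Ty → PTerm → PTerm

-- Typing (variables carry their types, so no context is needed)
infix 4 _∶_
data _∶_ : PTerm → Ty → Set where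
  ax   : ∀ {x A} → var x A ∶ A
  iso  : ∀ {r A B} → A ≅ B → r ∶ A → r ∶ B
  ⇒i   : ∀ {x A r B} → r ∶ B → lam x A r ∶ A ⇒ B
  ⇒e   : ∀ {r s A B} → r ∶ A ⇒ B → s ∶ A → r · s ∶ B
  ∧i   : ∀ {r s A B} → r ∶ A → s ∶ B → r ⊗ s ∶ A ∧ B
  ∧e   : ∀ {r A B} → r ∶ A ∧ B → proj A r ∶ A

-- Terms are the well-typed preterms
Typed : PTerm → Set
Typed r = Σ Ty (λ A → r ∶ A)

infix 4 _↝_
data _↝_ : PTerm → PTerm → Set where
  comm  : ∀ {r s} → r ⊗ s ↝ s ⊗ r
  asso  : ∀ {r s t} → (r ⊗ s) ⊗ t ↝ r ⊗ (s ⊗ t)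
  distλ : ∀ {x A r s} → lam x A (r ⊗ s) ↝ lam x A r ⊗ lam x A s
  curry : ∀ {r s t} → r · s · t ↝ r · (s ⊗ t)
  c-lam   : ∀ {x A r r'} → r ↝ r' → lam x A r ↝ lam x A r'
  c-appˡ  : ∀ {r r' s} → r ↝ r' → r · s ↝ r' · s
  c-appʳ  : ∀ {r s s'} → s ↝ s' → r · s ↝ r · s'
  c-pairˡ : ∀ {r r' s} → r ↝ r' → r ⊗ s ↝ r' ⊗ s
  c-pairʳ : ∀ {r s s'} → s ↝ s' → r ⊗ s ↝ r ⊗ s'
  c-proj  : ∀ {A r r'} → r ↝ r' → proj A r ↝ proj A r'

infix 4 _⇄_ _⇄*_
_⇄_ : PTerm → PTerm → Set
r ⇄ s = Typed r × Typed s × (r ↝ s ⊎ s ↝ r)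

_⇄*_ : PTerm → PTerm → Set
_⇄*_ = Star _⇄_

module Submission where

-- Every term t flattens into a non-empty list  atoms t  of
-- non-product components: products are concatenated and an abstraction
-- λx^A is pushed onto each component of its body.  Two facts make atoms
-- a complete invariant of ⇄*:
--   * t ⇄* prod (atoms t), where prod is the right-nested product of a list;
--   * a ⇄*-step permutes the atoms up to ⇄* (a curry step only rewrites
--     inside one atom), and prod of a permuted list stays ⇄*-equivalent.
-- Hence r ⊗ s ⇄* t gives a permutation (modulo ⇄*) of atoms r ++ atoms s
-- onto atoms t.  If t = u ⊗ v, a splitting lemma for permutations of
-- concatenations distributes the atoms into four blocks, and a case
-- analysis on which blocks are empty yields (1a), (1b) or (1c).  If
-- t = λx^A.a, every atom of r and s is an abstraction λx^A of an atom of
-- a, which gives (2).  Any other t has a single atom, which is impossible.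

open import Defs
open import Data.Product using (∃-syntax; ∃₂; _×_; _,_; proj₁; proj₂)
import Data.Product as Product
open import Data.Sum using (_⊎_; inj₁; inj₂)
import Data.Sum as Sum
open import Data.Nat using (pred)
open import Data.Empty using (⊥-elim)
open import Data.List using (List; []; _∷_; _++_; map; [_]; length)
import Data.List.Properties as List
open import Data.List.Relation.Unary.All using (All; []; _∷_)
import Data.List.Relation.Unary.All as All
import Data.List.Relation.Unary.All.Properties as All
open import Data.List.Relation.Unary.Any using (Any; here; there)
import Data.List.Relation.Unary.Any.Properties as Any
open import Data.List.Relation.Binary.Pointwise using (Pointwise; []; _∷_)
open import Relation.Binary.Bundles using (Setoid)
open import Relation.Binary.PropositionalEquality using (_≡_; _≢_; refl; sym; cong; cong₂)
open import Relation.Binary.Construct.Closure.ReflexiveTransitive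
  using (ε; _◅_; _◅◅_; gmap; reverse)
open import Relation.Nullary using (¬_)
open import Function using (id)

⊗-typed : ∀ {p q} → Typed p → Typed q → Typed (p ⊗ q)
⊗-typed (A , d) (B , e) = A ∧ B , ∧i d e

lam-typed : ∀ {x A p} → Typed p → Typed (lam x A p)
lam-typed {A = A} (B , d) = A ⇒ B , ⇒i d

⊗-typed⁻ : ∀ {p q} → Typed (p ⊗ q) → Typed p × Typed q
⊗-typed⁻ (_ , d) = components d
  where
  components : ∀ {p q C} → p ⊗ q ∶ C → Typed p × Typed q
  components (iso _ d) = components d
  components (∧i d e)  = (_ , d) , (_ , e)

lam-typed⁻ : ∀ {x A p} → Typed (lam x A p) → Typed p
lam-typed⁻ (_ , d) = body d
  where
  body : ∀ {x A p C} → lam x A p ∶ C → Typed p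
  body (iso _ d) = body d
  body (⇒i d)    = _ , d

⇄*-sym : ∀ {p q} → p ⇄* q → q ⇄* p
⇄*-sym = reverse λ { (tp , tq , st) → tq , tp , Sum.swap st }

⇄*-typed : ∀ {p q} → p ⇄* q → Typed p → Typed q
⇄*-typed ε                   tp = tp
⇄*-typed ((_ , tq , _) ◅ ss) _  = ⇄*-typed ss tq

step : ∀ {p q} → Typed p → Typed q → p ↝ q → p ⇄* q
step tp tq st = (tp , tq , inj₁ st) ◅ ε

step⁻ : ∀ {p q} → Typed p → Typed q → q ↝ p → p ⇄* q
step⁻ tp tq st = (tp , tq , inj₂ st) ◅ ε

⇄*-context : (C : PTerm → PTerm) → (∀ {p} → Typed p → Typed (C p)) →
  (∀ {p q} → p ↝ q → C p ↝ C q) → ∀ {p q} → p ⇄* q → C p ⇄* C q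
⇄*-context C typed congruent =
  gmap C λ { (tp , tq , st) → typed tp , typed tq , Sum.map congruent congruent st }

⇄*-lam : ∀ {x A p q} → p ⇄* q → lam x A p ⇄* lam x A q
⇄*-lam {x} {A} = ⇄*-context (lam x A) lam-typed c-lam

⇄*-⊗ˡ : ∀ {p p' q} → Typed q → p ⇄* p' → p ⊗ q ⇄* p' ⊗ q
⇄*-⊗ˡ {q = q} tq = ⇄*-context (_⊗ q) (λ tp → ⊗-typed tp tq) c-pairˡ

⇄*-⊗ʳ : ∀ {p q q'} → Typed p → q ⇄* q' → p ⊗ q ⇄* p ⊗ q'
⇄*-⊗ʳ {p} tp = ⇄*-context (p ⊗_) (⊗-typed tp) c-pairʳ

⇄*-⊗ : ∀ {p p' q q'} → Typed p' → Typed q → p ⇄* p' → q ⇄* q' → p ⊗ q ⇄* p' ⊗ q'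
⇄*-⊗ tp' tq e f = ⇄*-⊗ˡ tq e ◅◅ ⇄*-⊗ʳ tp' f

⇄*-setoid : Setoid _ _
⇄*-setoid = record
  { Carrier       = PTerm
  ; _≈_           = _⇄*_
  ; isEquivalence = record { refl = ε ; sym = ⇄*-sym ; trans = _◅◅_ }
  }

open import Data.List.Relation.Binary.Permutation.Setoid ⇄*-setoid
  using (_↭_; prep; swap; ↭-refl; ↭-reflexive; ↭-sym; ↭-trans; ↭-prep; ↭-swap)
  renaming (refl to ↭-pointwise; trans to ↭-trans′)
open import Data.List.Relation.Binary.Permutation.Setoid.Properties ⇄*-setoid
  using (All-resp-↭; ∈-resp-↭; ¬x∷xs↭[]; xs↭ys⇒|xs|≡|ys|; ↭-shift;
         drop-∷; map⁺; ++⁺ʳ; ++⁺ˡ; ++-comm; ++-identityʳ)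

-- Products of non-empty lists: prod (x₁ ∷ … ∷ xₙ) = x₁ ⊗ (… ⊗ xₙ).
-- (prod [] is an arbitrary dummy: every lemma about prod assumes a non-empty list.)

data NonEmpty : List PTerm → Set where
  nonEmpty : ∀ {x xs} → NonEmpty (x ∷ xs)

prod : List PTerm → PTerm
prod []           = var 0 τ
prod (x ∷ [])     = x
prod (x ∷ y ∷ ys) = x ⊗ prod (y ∷ ys)

prod-typed : ∀ {xs} → NonEmpty xs → All Typed xs → Typed (prod xs)
prod-typed nonEmpty (t ∷ [])         = t
prod-typed nonEmpty (t ∷ ts@(_ ∷ _)) = ⊗-typed t (prod-typed nonEmpty ts)

prod-++ : ∀ {xs ys} → NonEmpty xs → NonEmpty ys → All Typed xs → All Typed ys →
  prod xs ⊗ prod ys ⇄* prod (xs ++ ys)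
prod-++ {_ ∷ []}     nonEmpty nonEmpty _          _   = ε
prod-++ {_ ∷ xs@(_ ∷ _)} {ys} nonEmpty nonEmpty (tx ∷ txs) tys =
  step (⊗-typed (⊗-typed tx P) Q) (⊗-typed tx (⊗-typed P Q)) asso
    ◅◅ ⇄*-⊗ʳ tx (prod-++ nonEmpty nonEmpty txs tys)
  where
  P : Typed (prod xs)
  P = prod-typed nonEmpty txs
  Q : Typed (prod ys)
  Q = prod-typed nonEmpty tys

lam-prod : ∀ {x A xs} → NonEmpty xs → All Typed xs →
  lam x A (prod xs) ⇄* prod (map (lam x A) xs)
lam-prod {xs = _ ∷ []}    nonEmpty _         = ε
lam-prod {xs = _ ∷ ys@(_ ∷ _)} nonEmpty (ty ∷ tys) =
  step (lam-typed (⊗-typed ty P)) (⊗-typed (lam-typed ty) (lam-typed P)) distλ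
    ◅◅ ⇄*-⊗ʳ (lam-typed ty) (lam-prod nonEmpty tys)
  where
  P : Typed (prod ys)
  P = prod-typed nonEmpty tys

prod-∷ : ∀ {x y xs ys} → Typed x → All Typed xs → x ⇄* y → xs ↭ ys →
  prod xs ⇄* prod ys → prod (x ∷ xs) ⇄* prod (y ∷ ys)
prod-∷ {xs = []}    {[]}    _  _  e _ _ = e
prod-∷ {xs = _ ∷ _} {_ ∷ _} tx ts e _ f = ⇄*-⊗ (⇄*-typed e tx) (prod-typed nonEmpty ts) e f
prod-∷ {xs = []}    {_ ∷ _} _  _  _ p _ = ⊥-elim (¬x∷xs↭[] (↭-sym p))
prod-∷ {xs = _ ∷ _} {[]}    _  _  _ p _ = ⊥-elim (¬x∷xs↭[] p)

prod-swap : ∀ {x y} zs → Typed x → Typed y → All Typed zs →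
  prod (x ∷ y ∷ zs) ⇄* prod (y ∷ x ∷ zs)
prod-swap []      tx ty _  = step (⊗-typed tx ty) (⊗-typed ty tx) comm
prod-swap zs@(_ ∷ _) tx ty ts =
  step⁻ (⊗-typed tx (⊗-typed ty P)) (⊗-typed (⊗-typed tx ty) P) asso
    ◅◅ step (⊗-typed (⊗-typed tx ty) P) (⊗-typed (⊗-typed ty tx) P) (c-pairˡ comm)
    ◅◅ step (⊗-typed (⊗-typed ty tx) P) (⊗-typed ty (⊗-typed tx P)) asso
  where
  P : Typed (prod zs)
  P = prod-typed nonEmpty ts

prod-≋ : ∀ {xs ys} → Pointwise _⇄*_ xs ys → All Typed xs → prod xs ⇄* prod ys
prod-≋ []       _        = ε
prod-≋ (e ∷ es) (t ∷ ts) = prod-∷ t ts e (↭-pointwise es) (prod-≋ es ts)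

prod-↭ : ∀ {xs ys} → xs ↭ ys → All Typed xs → prod xs ⇄* prod ys
prod-↭ (↭-pointwise es) ts            = prod-≋ es ts
prod-↭ (prep e p)       (t ∷ ts)      = prod-∷ t ts e p (prod-↭ p ts)
prod-↭ (swap {xs = zs} e₁ e₂ p) (tx ∷ ty ∷ ts) =
  prod-swap zs tx ty ts
    ◅◅ prod-∷ ty (tx ∷ ts) e₂ (prep e₁ p) (prod-∷ tx ts e₁ p (prod-↭ p ts))
prod-↭ (↭-trans′ p q)   ts            = prod-↭ p ts ◅◅ prod-↭ q (All-resp-↭ ⇄*-typed p ts)

atoms : PTerm → List PTerm
atoms (p ⊗ q)     = atoms p ++ atoms q
atoms (lam x A p) = map (lam x A) (atoms p)
atoms (var n A)   = [ var n A ]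
atoms (p · q)     = [ p · q ]
atoms (proj A p)  = [ proj A p ]

atoms-nonEmpty : ∀ t → NonEmpty (atoms t)
atoms-nonEmpty (p ⊗ q) with atoms p | atoms-nonEmpty p
... | _ ∷ _ | nonEmpty = nonEmpty
atoms-nonEmpty (lam x A p) with atoms p | atoms-nonEmpty p
... | _ ∷ _ | nonEmpty = nonEmpty
atoms-nonEmpty (var n A)  = nonEmpty
atoms-nonEmpty (p · q)    = nonEmpty
atoms-nonEmpty (proj A p) = nonEmpty

atoms-typed : ∀ t → Typed t → All Typed (atoms t)
atoms-typed (p ⊗ q) tt =
  All.++⁺ (atoms-typed p (proj₁ (⊗-typed⁻ tt))) (atoms-typed q (proj₂ (⊗-typed⁻ tt)))
atoms-typed (lam x A p) tt = All.map⁺ (All.map lam-typed (atoms-typed p (lam-typed⁻ tt)))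
atoms-typed (var n A)  tt = tt ∷ []
atoms-typed (p · q)    tt = tt ∷ []
atoms-typed (proj A p) tt = tt ∷ []

⇄*-prod-atoms : ∀ t → Typed t → t ⇄* prod (atoms t)
⇄*-prod-atoms (p ⊗ q) tt =
  ⇄*-⊗ (prod-typed (atoms-nonEmpty p) (atoms-typed p tp)) tq
       (⇄*-prod-atoms p tp) (⇄*-prod-atoms q tq)
    ◅◅ prod-++ (atoms-nonEmpty p) (atoms-nonEmpty q) (atoms-typed p tp) (atoms-typed q tq)
  where
  tp : Typed p
  tp = proj₁ (⊗-typed⁻ tt)
  tq : Typed q
  tq = proj₂ (⊗-typed⁻ tt)
⇄*-prod-atoms (lam x A p) tt =
  ⇄*-lam (⇄*-prod-atoms p tp) ◅◅ lam-prod (atoms-nonEmpty p) (atoms-typed p tp)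
  where
  tp : Typed p
  tp = lam-typed⁻ tt
⇄*-prod-atoms (var n A)  _ = ε
⇄*-prod-atoms (p · q)    _ = ε
⇄*-prod-atoms (proj A p) _ = ε

-- A step permutes the atoms modulo ⇄*: the axioms comm, asso and distλ
-- permute them literally, a curry step (or any step under an application
-- or projection) rewrites a single atom.
atoms-↝ : ∀ {t t'} → Typed t → Typed t' → t ↝ t' → atoms t ↭ atoms t'
atoms-↝ _ _ (comm {r} {s})        = ++-comm (atoms r) (atoms s)
atoms-↝ _ _ (asso {r} {s} {t})    = ↭-reflexive (List.++-assoc (atoms r) (atoms s) (atoms t))
atoms-↝ _ _ (distλ {x} {A} {r} {s}) = ↭-reflexive (List.map-++ (lam x A) (atoms r) (atoms s))
atoms-↝ tt tt' (c-lam st)  = map⁺ ⇄*-setoid ⇄*-lam (atoms-↝ (lam-typed⁻ tt) (lam-typed⁻ tt') st)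
atoms-↝ tt tt' (c-pairˡ {s = s} st) =
  ++⁺ʳ (atoms s) (atoms-↝ (proj₁ (⊗-typed⁻ tt)) (proj₁ (⊗-typed⁻ tt')) st)
atoms-↝ tt tt' (c-pairʳ {r = r} st) =
  ++⁺ˡ (atoms r) (atoms-↝ (proj₂ (⊗-typed⁻ tt)) (proj₂ (⊗-typed⁻ tt')) st)
atoms-↝ tt tt' st@curry      = ↭-pointwise (step tt tt' st ∷ [])
atoms-↝ tt tt' st@(c-appˡ _) = ↭-pointwise (step tt tt' st ∷ [])
atoms-↝ tt tt' st@(c-appʳ _) = ↭-pointwise (step tt tt' st ∷ [])
atoms-↝ tt tt' st@(c-proj _) = ↭-pointwise (step tt tt' st ∷ [])

atoms-⇄* : ∀ {t t'} → t ⇄* t' → atoms t ↭ atoms t'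
atoms-⇄* ε                             = ↭-refl
atoms-⇄* ((tt , tt' , inj₁ st) ◅ ss) = ↭-trans (atoms-↝ tt tt' st) (atoms-⇄* ss)
atoms-⇄* ((tt , tt' , inj₂ st) ◅ ss) = ↭-trans (↭-sym (atoms-↝ tt' tt st)) (atoms-⇄* ss)

permuted-typed : ∀ {p xs} → Typed p → atoms p ↭ xs → All Typed xs
permuted-typed {p} tp h = All-resp-↭ ⇄*-typed h (atoms-typed p tp)

⇄*-prod : ∀ {p xs} → Typed p → atoms p ↭ xs → p ⇄* prod xs
⇄*-prod {p} tp h = ⇄*-prod-atoms p tp ◅◅ prod-↭ h (atoms-typed p tp)

⇄*-by-atoms : ∀ {p q xs} → Typed p → Typed q → atoms p ↭ xs → atoms q ↭ xs → p ⇄* q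
⇄*-by-atoms tp tq hp hq = ⇄*-prod tp hp ◅◅ ⇄*-sym (⇄*-prod tq hq)

⇄*-split : ∀ {p} xs {ys} → Typed p → atoms p ↭ xs ++ ys → NonEmpty xs → NonEmpty ys →
  p ⇄* prod xs ⊗ prod ys
⇄*-split xs {ys} tp h nx ny =
  ⇄*-prod tp h ◅◅ ⇄*-sym (prod-++ nx ny (All.++⁻ˡ xs ts) (All.++⁻ʳ xs ts))
  where
  ts : All Typed (xs ++ ys)
  ts = permuted-typed tp h

blocks-typed : ∀ {p} xs {ys} → Typed p → atoms p ↭ xs ++ ys → NonEmpty xs → NonEmpty ys →
  Typed (prod xs) × Typed (prod ys)
blocks-typed xs {ys} tp h nx ny = prod-typed nx (All.++⁻ˡ xs ts) , prod-typed ny (All.++⁻ʳ xs ts)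
  where
  ts : All Typed (xs ++ ys)
  ts = permuted-typed tp h

¬atoms↭[] : ∀ t → ¬ (atoms t ↭ [])
¬atoms↭[] t h with atoms t | atoms-nonEmpty t
... | _ ∷ _ | nonEmpty = ¬x∷xs↭[] h

length-++-∷≢0 : ∀ xs {y : PTerm} ys → length (xs ++ y ∷ ys) ≢ 0
length-++-∷≢0 []      _ ()
length-++-∷≢0 (_ ∷ _) _ ()

¬two↭one : ∀ {xs ys z} → NonEmpty xs → NonEmpty ys → ¬ (xs ++ ys ↭ [ z ])
¬two↭one {_ ∷ xs} {_ ∷ ys} nonEmpty nonEmpty h =
  length-++-∷≢0 xs ys (cong pred (xs↭ys⇒|xs|≡|ys| h))

extract : ∀ {P : PTerm → Set} {cs} → Any P cs → ∃₂ λ w cs' → P w × cs ↭ w ∷ cs'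
extract (here p) = _ , _ , p , ↭-refl
extract {cs = c ∷ _} (there a) with extract a
... | w , cs' , p , h = w , c ∷ cs' , p , ↭-trans (↭-prep c h) (↭-swap c w ↭-refl)

-- A permutation of as ++ bs onto map f cs ++ map f ds cuts each of the four
-- lists into blocks: a₁/b₁ are the parts of cs matched with as/bs, and
-- a₂/b₂ those of ds.
record Interleaving (f : PTerm → PTerm) (as bs cs ds : List PTerm) : Set where
  constructor interleaving
  field
    a₁ a₂ b₁ b₂ : List PTerm
    cs-blocks : cs ↭ a₁ ++ b₁
    ds-blocks : ds ↭ a₂ ++ b₂
    as-blocks : as ↭ map f a₁ ++ map f a₂
    bs-blocks : bs ↭ map f b₁ ++ map f b₂

dropʳ : ∀ {xs ys} → xs ↭ ys ++ [] → xs ↭ ys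
dropʳ h = ↭-trans h (++-identityʳ _)

module _ (f : PTerm → PTerm) (f-cong : ∀ {p q} → p ⇄* q → f p ⇄* f q) where

  front-cs : ∀ {cs w cs'} ds → cs ↭ w ∷ cs' →
    map f cs ++ map f ds ↭ f w ∷ map f cs' ++ map f ds
  front-cs ds cs↭ = ++⁺ʳ (map f ds) (map⁺ ⇄*-setoid f-cong cs↭)

  front-ds : ∀ {ds w ds'} cs → ds ↭ w ∷ ds' →
    map f cs ++ map f ds ↭ f w ∷ map f cs ++ map f ds'
  front-ds {ds' = ds'} cs ds↭ =
    ↭-trans (++⁺ˡ (map f cs) (map⁺ ⇄*-setoid f-cong ds↭)) (↭-shift (map f cs) (map f ds'))

  cancel-head : ∀ {x y xs ys zs} → x ⇄* y → x ∷ xs ↭ zs → zs ↭ y ∷ ys → xs ↭ ys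
  cancel-head x≈y h h' = drop-∷ (↭-trans h (↭-trans h' (prep (⇄*-sym x≈y) ↭-refl)))

  -- By induction on as: the head x of as is equivalent to some f w, where w
  -- occurs in cs or in ds; w joins block a₁ or a₂ accordingly.
  interleave : ∀ as {bs} cs ds → as ++ bs ↭ map f cs ++ map f ds → Interleaving f as bs cs ds
  interleave [] cs ds h = interleaving [] [] cs ds ↭-refl ↭-refl ↭-refl h
  interleave (x ∷ as) cs ds h with Any.++⁻ (map f cs) (∈-resp-↭ h (here ε))
  ... | inj₁ x∈cs with extract (Any.map⁻ x∈cs)
  ... | w , cs' , x≈fw , cs↭ with interleave as cs' ds (cancel-head x≈fw h (front-cs ds cs↭))
  ... | interleaving a₁ a₂ b₁ b₂ h₁ h₂ h₃ h₄ =
    interleaving (w ∷ a₁) a₂ b₁ b₂ (↭-trans cs↭ (↭-prep w h₁)) h₂ (prep x≈fw h₃) h₄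
  interleave (x ∷ as) cs ds h | inj₂ x∈ds with extract (Any.map⁻ x∈ds)
  ... | w , ds' , x≈fw , ds↭ with interleave as cs ds' (cancel-head x≈fw h (front-ds cs ds↭))
  ... | interleaving a₁ a₂ b₁ b₂ h₁ h₂ h₃ h₄ =
    interleaving a₁ (w ∷ a₂) b₁ b₂ h₁ (↭-trans ds↭ (↭-prep w h₂))
      (↭-trans (prep x≈fw h₃) (↭-sym (↭-shift (map f a₁) (map f a₂)))) h₄

  split-map : ∀ as {bs} cs → as ++ bs ↭ map f cs →
    ∃₂ λ a b → cs ↭ a ++ b × as ↭ map f a × bs ↭ map f b
  split-map as cs h with interleave as cs [] (↭-trans h (↭-sym (++-identityʳ _)))
  ... | interleaving a₁ [] b₁ [] h₁ _ h₃ h₄ = a₁ , b₁ , h₁ , dropʳ h₃ , dropʳ h₄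
  ... | interleaving _ (_ ∷ _) _ _ _ h₂ _ _ = ⊥-elim (¬x∷xs↭[] (↭-sym h₂))
  ... | interleaving _ [] _ (_ ∷ _) _ h₂ _ _ = ⊥-elim (¬x∷xs↭[] (↭-sym h₂))

map-id-++ : (ys zs : List PTerm) → map id ys ++ map id zs ≡ ys ++ zs
map-id-++ ys zs = cong₂ _++_ (List.map-id ys) (List.map-id zs)

interleave-++ : ∀ as {bs} cs ds → as ++ bs ↭ cs ++ ds →
  ∃₂ λ a₁ a₂ → ∃₂ λ b₁ b₂ →
    cs ↭ a₁ ++ b₁ × ds ↭ a₂ ++ b₂ × as ↭ a₁ ++ a₂ × bs ↭ b₁ ++ b₂
interleave-++ as cs ds h
  with interleave id id as cs ds (↭-trans h (↭-reflexive (sym (map-id-++ cs ds))))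
... | interleaving a₁ a₂ b₁ b₂ h₁ h₂ h₃ h₄ =
  a₁ , a₂ , b₁ , b₂ , h₁ , h₂ ,
  ↭-trans h₃ (↭-reflexive (map-id-++ a₁ a₂)) , ↭-trans h₄ (↭-reflexive (map-id-++ b₁ b₂))

PairCases : PTerm → PTerm → PTerm → PTerm → Set
PairCases r s u v =
    (∃[ t₁₁ ] ∃[ t₁₂ ] ∃[ t₂₁ ] ∃[ t₂₂ ]
      (Typed t₁₁ × Typed t₁₂ × Typed t₂₁ × Typed t₂₂ ×
       u ⇄* t₁₁ ⊗ t₂₁ × v ⇄* t₁₂ ⊗ t₂₂ × r ⇄* t₁₁ ⊗ t₁₂ × s ⇄* t₂₁ ⊗ t₂₂))
  ⊎ (∃[ w ] (Typed w ×
      ((v ⇄* w ⊗ s × r ⇄* u ⊗ w)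
       ⊎ (v ⇄* w ⊗ r × s ⇄* u ⊗ w)
       ⊎ (u ⇄* w ⊗ s × r ⇄* v ⊗ w)
       ⊎ (u ⇄* w ⊗ r × s ⇄* v ⊗ w))))
  ⊎ ((r ⇄* u × s ⇄* v) ⊎ (r ⇄* v × s ⇄* u))

-- Shape of case (1b): r = u ⊗ w and v = w ⊗ s at the level of atoms.
-- All four variants of (1b) are instances, with r/s and u/v exchanged.
shared-block : ∀ {r s u v} xs ws ys → Typed r → Typed s → Typed u → Typed v →
  NonEmpty xs → NonEmpty ws → NonEmpty ys →
  atoms r ↭ xs ++ ws → atoms u ↭ xs → atoms v ↭ ws ++ ys → atoms s ↭ ys →
  ∃[ w ] (Typed w × v ⇄* w ⊗ s × r ⇄* u ⊗ w)
shared-block xs ws ys tr ts tu tv nx nw ny hr hu hv hs =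
  prod ws , tw ,
  ⇄*-split ws tv hv nw ny ◅◅ ⇄*-⊗ʳ tw (⇄*-sym (⇄*-prod ts hs)) ,
  ⇄*-split xs tr hr nx nw ◅◅ ⇄*-⊗ˡ tw (⇄*-sym (⇄*-prod tu hu))
  where
  tw : Typed (prod ws)
  tw = proj₂ (blocks-typed xs tr hr nx nw)

variant : ∀ {P Q : PTerm → Set} → (∀ {w} → P w → Q w) →
  ∃[ w ] (Typed w × P w) → ∃[ w ] (Typed w × Q w)
variant f = Product.map₂ (Product.map₂ f)

-- Case analysis on which of the four blocks of an interleaving are empty:
-- all non-empty gives (1a), three non-empty gives (1b), two diagonal
-- blocks give (1c); every other pattern would make one of r, s, u, v atomless.
by-blocks : ∀ {r s u v} → Typed r → Typed s → Typed u → Typed v → ∀ a₁ a₂ b₁ b₂ →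
  atoms u ↭ a₁ ++ b₁ → atoms v ↭ a₂ ++ b₂ → atoms r ↭ a₁ ++ a₂ → atoms s ↭ b₁ ++ b₂ →
  PairCases r s u v
by-blocks {u = u} _ _ _ _ [] _ [] _ h₁ _ _ _ = ⊥-elim (¬atoms↭[] u h₁)
by-blocks {v = v} _ _ _ _ _ [] _ [] _ h₂ _ _ = ⊥-elim (¬atoms↭[] v h₂)
by-blocks {r = r} _ _ _ _ [] [] _ _ _ _ h₃ _ = ⊥-elim (¬atoms↭[] r h₃)
by-blocks {s = s} _ _ _ _ _ _ [] [] _ _ _ h₄ = ⊥-elim (¬atoms↭[] s h₄)
by-blocks tr ts tu tv a₁@(_ ∷ _) a₂@(_ ∷ _) b₁@(_ ∷ _) b₂@(_ ∷ _) h₁ h₂ h₃ h₄ =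
  inj₁ (prod a₁ , prod a₂ , prod b₁ , prod b₂ ,
        proj₁ (blocks-typed a₁ tu h₁ nonEmpty nonEmpty) ,
        proj₁ (blocks-typed a₂ tv h₂ nonEmpty nonEmpty) ,
        proj₂ (blocks-typed a₁ tu h₁ nonEmpty nonEmpty) ,
        proj₂ (blocks-typed a₂ tv h₂ nonEmpty nonEmpty) ,
        ⇄*-split a₁ tu h₁ nonEmpty nonEmpty , ⇄*-split a₂ tv h₂ nonEmpty nonEmpty ,
        ⇄*-split a₁ tr h₃ nonEmpty nonEmpty , ⇄*-split b₁ ts h₄ nonEmpty nonEmpty)
by-blocks tr ts tu tv [] a₂@(_ ∷ _) b₁@(_ ∷ _) b₂@(_ ∷ _) h₁ h₂ h₃ h₄ =
  inj₂ (inj₁ (variant (λ e → inj₂ (inj₁ e))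
    (shared-block b₁ b₂ a₂ ts tr tu tv nonEmpty nonEmpty nonEmpty
       h₄ h₁ (↭-trans h₂ (++-comm a₂ b₂)) h₃)))
by-blocks tr ts tu tv a₁@(_ ∷ _) [] b₁@(_ ∷ _) b₂@(_ ∷ _) h₁ h₂ h₃ h₄ =
  inj₂ (inj₁ (variant (λ e → inj₂ (inj₂ (inj₂ e)))
    (shared-block b₂ b₁ a₁ ts tr tv tu nonEmpty nonEmpty nonEmpty
       (↭-trans h₄ (++-comm b₁ b₂)) h₂ (↭-trans h₁ (++-comm a₁ b₁)) (dropʳ h₃))))
by-blocks tr ts tu tv a₁@(_ ∷ _) a₂@(_ ∷ _) [] b₂@(_ ∷ _) h₁ h₂ h₃ h₄ =
  inj₂ (inj₁ (variant inj₁
    (shared-block a₁ a₂ b₂ tr ts tu tv nonEmpty nonEmpty nonEmpty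
       h₃ (dropʳ h₁) h₂ h₄)))
by-blocks tr ts tu tv a₁@(_ ∷ _) a₂@(_ ∷ _) b₁@(_ ∷ _) [] h₁ h₂ h₃ h₄ =
  inj₂ (inj₁ (variant (λ e → inj₂ (inj₂ (inj₁ e)))
    (shared-block a₂ a₁ b₁ tr ts tv tu nonEmpty nonEmpty nonEmpty
       (↭-trans h₃ (++-comm a₁ a₂)) (dropʳ h₂) h₁ (dropʳ h₄))))
by-blocks tr ts tu tv [] a₂@(_ ∷ _) b₁@(_ ∷ _) [] h₁ h₂ h₃ h₄ =
  inj₂ (inj₂ (inj₂ (⇄*-by-atoms tr tv h₃ (dropʳ h₂) , ⇄*-by-atoms ts tu (dropʳ h₄) h₁)))
by-blocks tr ts tu tv a₁@(_ ∷ _) [] [] b₂@(_ ∷ _) h₁ h₂ h₃ h₄ =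
  inj₂ (inj₂ (inj₁ (⇄*-by-atoms tr tu (dropʳ h₃) (dropʳ h₁) , ⇄*-by-atoms ts tv h₄ h₂)))

pair-case : ∀ {r s u v} → Typed r → Typed s → Typed u → Typed v →
  atoms r ++ atoms s ↭ atoms u ++ atoms v → PairCases r s u v
pair-case {r} {u = u} {v} tr ts tu tv h with interleave-++ (atoms r) (atoms u) (atoms v) h
... | a₁ , a₂ , b₁ , b₂ , h₁ , h₂ , h₃ , h₄ = by-blocks tr ts tu tv a₁ a₂ b₁ b₂ h₁ h₂ h₃ h₄

-- Case t = λx^A.a: the atoms of r and s are abstractions λx^A of the
-- atoms of a, so a splits into the corresponding two blocks.
lam-case : ∀ {r s x A a} → Typed r → Typed s → Typed a →
  atoms r ++ atoms s ↭ map (lam x A) (atoms a) →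
  ∃[ a₁ ] ∃[ a₂ ] (Typed a₁ × Typed a₂ × a ⇄* a₁ ⊗ a₂ × r ⇄* lam x A a₁ × s ⇄* lam x A a₂)
lam-case {r} {s} {x} {A} {a} tr ts ta h with split-map (lam x A) ⇄*-lam (atoms r) (atoms a) h
... | [] , _ , _ , hr , _ = ⊥-elim (¬atoms↭[] r hr)
... | _ , [] , _ , _ , hs = ⊥-elim (¬atoms↭[] s hs)
... | xs@(_ ∷ _) , ys@(_ ∷ _) , ha , hr , hs =
  prod xs , prod ys ,
  proj₁ (blocks-typed xs ta ha nonEmpty nonEmpty) ,
  proj₂ (blocks-typed xs ta ha nonEmpty nonEmpty) ,
  ⇄*-split xs ta ha nonEmpty nonEmpty ,
  ⇄*-prod tr hr ◅◅ ⇄*-sym (lam-prod nonEmpty (All.++⁻ˡ xs tas)) ,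
  ⇄*-prod ts hs ◅◅ ⇄*-sym (lam-prod nonEmpty (All.++⁻ʳ xs tas))
  where
  tas : All Typed (xs ++ ys)
  tas = permuted-typed ta ha

mainTheorem10 : (r s t : PTerm) → Typed r → Typed s → Typed t → r ⊗ s ⇄* t →
    (∃[ u ] ∃[ v ] (Typed u × Typed v × t ≡ u ⊗ v ×
      ((∃[ t₁₁ ] ∃[ t₁₂ ] ∃[ t₂₁ ] ∃[ t₂₂ ]
          (Typed t₁₁ × Typed t₁₂ × Typed t₂₁ × Typed t₂₂ ×
           u ⇄* t₁₁ ⊗ t₂₁ × v ⇄* t₁₂ ⊗ t₂₂ × r ⇄* t₁₁ ⊗ t₁₂ × s ⇄* t₂₁ ⊗ t₂₂))
       ⊎ (∃[ w ] (Typed w ×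
           ((v ⇄* w ⊗ s × r ⇄* u ⊗ w)
            ⊎ (v ⇄* w ⊗ r × s ⇄* u ⊗ w)
            ⊎ (u ⇄* w ⊗ s × r ⇄* v ⊗ w)
            ⊎ (u ⇄* w ⊗ r × s ⇄* v ⊗ w))))
       ⊎ ((r ⇄* u × s ⇄* v) ⊎ (r ⇄* v × s ⇄* u)))))
    ⊎ (∃[ x ] ∃[ A ] ∃[ a ] ∃[ a₁ ] ∃[ a₂ ]
        (Typed a₁ × Typed a₂ × t ≡ lam x A a ×
         a ⇄* a₁ ⊗ a₂ × r ⇄* lam x A a₁ × s ⇄* lam x A a₂))
mainTheorem10 r s (u ⊗ v) tr ts tt h =
  inj₁ (u , v , tu , tv , refl , pair-case tr ts tu tv (atoms-⇄* h))
  where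
  tu : Typed u
  tu = proj₁ (⊗-typed⁻ tt)
  tv : Typed v
  tv = proj₂ (⊗-typed⁻ tt)
mainTheorem10 r s (lam x A a) tr ts tt h with lam-case tr ts (lam-typed⁻ tt) (atoms-⇄* h)
... | a₁ , a₂ , t₁ , t₂ , ha , hr , hs = inj₂ (x , A , a , a₁ , a₂ , t₁ , t₂ , refl , ha , hr , hs)
mainTheorem10 r s (var _ _)  _ _ _ h = ⊥-elim (¬two↭one (atoms-nonEmpty r) (atoms-nonEmpty s) (atoms-⇄* h))
mainTheorem10 r s (_ · _)    _ _ _ h = ⊥-elim (¬two↭one (atoms-nonEmpty r) (atoms-nonEmpty s) (atoms-⇄* h))
mainTheorem10 r s (proj _ _) _ _ _ h = ⊥-elim (¬two↭one (atoms-nonEmpty r) (atoms-nonEmpty s) (atoms-⇄* h))
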